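{- Let $y\in\mathcal I_\infty$. If $v,w\in\mathcal A(y)$ and $v<_\mathcal{A}w$, then $\lambda(v)<\lambda(w)$ in dominance order.
   Context: $\mathcal I_\infty$ is the set of involutions of the positive integers with finite support; $S_\infty$ the finitely supported permutations of the positive integers; $s_i=(i,i+1)$. The Demazure product $\circ$ is the associative product with $u\circ v=uv$ when $\ell(uv)=\ell(u)+\ell(v)$ and $s_i\circ s_i=s_i$; $\mathcal A(y)$ is the set of minimal-length $w\in S_\infty$ with $w^{ -1}\circ w=y$. The relation $<_\mathcal{A}$ on $S_\infty$ is the transitive relation generated by setting $v<_\mathcal{A}w$ when the one-line representation of $v^{ -1}$ can be transformed into that of $w^{ -1}$ by replacing a consecutive subsequence $cab$ with $a<b<c$ by $bca$. For $w\in S_\infty$, the code is $c(w)=(c_1,c_2,\dots)$ with $c_i=|\{j>i:w(j)<w(i)\}|$, and $\lambda(w)$ is the partition obtained by sorting $c(w)$ into decreasing order. -}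

module Defs where

open import Data.Nat using (ℕ; zero; suc; _+_; _≤_; _<_; _<ᵇ_; _≡ᵇ_)
open import Data.Nat.Properties using (≤-decTotalOrder)
open import Data.Bool using (Bool; true; false; if_then_else_)
open import Data.List using (List; []; _∷_; length; filter; reverse; take; foldl; foldr; upTo; map; applyUpTo)
open import Data.List.Sort.MergeSort ≤-decTotalOrder using (sort)
open import Data.Nat.ListAction using (sum)
open import Data.Product using (Σ; ∃; _×_; _,_)
open import Relation.Nullary using (¬_)
open import Relation.Binary.PropositionalEquality using (_≡_; _≢_)
open import Relation.Binary.Construct.Closure.Transitive using (TransClosure)
open import Relation.Nullary.Decidable using (⌊_⌋)
open import Data.Nat using (_≟_; _<?_)

-- Conventions: the positive integers 1,2,3,... are encoded as 0,1,2,...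
-- (index shift by one).  So s i below is the paper's s_{i+1}.

record Perm : Set where
  field
    fun   : ℕ → ℕ
    inv   : ℕ → ℕ
    bound : ℕ
    fix   : ∀ i → bound ≤ i → fun i ≡ i
    invˡ  : ∀ i → inv (fun i) ≡ i
    invʳ  : ∀ i → fun (inv i) ≡ i
open Perm public

_⁻¹ : Perm → Perm
w ⁻¹ = record
  { fun = inv w ; inv = fun w ; bound = bound w
  ; fix = λ i b → Relation.Binary.PropositionalEquality.trans
                   (Relation.Binary.PropositionalEquality.cong (inv w)
                     (Relation.Binary.PropositionalEquality.sym (fix w i b)))
                   (invˡ w i)
  ; invˡ = invʳ w ; invʳ = invˡ w }

_≈_ : Perm → Perm → Set
u ≈ v = ∀ x → fun u x ≡ fun v x

IsInvolution : Perm → Set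
IsInvolution y = ∀ x → fun y (fun y x) ≡ x

count : (ℕ → Bool) → List ℕ → ℕ
count p xs = length (filter (λ x → p x Data.Bool.≟ true) xs)

-- Coxeter length = number of inversions (i < j, w i > w j);
-- all inversions lie below the bound.
ℓ : Perm → ℕ
ℓ w = sum (map (λ i → count (λ j → (i <ᵇ j) Data.Bool.∧ (fun w j <ᵇ fun w i))
                              (upTo (bound w)))
               (upTo (bound w)))

s : ℕ → ℕ → ℕ
s i x = if x ≡ᵇ i then suc i else (if x ≡ᵇ suc i then i else x)

wordFun : List ℕ → ℕ → ℕ
wordFun []       x = x
wordFun (a ∷ as) x = s a (wordFun as x)

-- Demazure right action of s_i: u ∘ s_i = u s_i if ℓ(u s_i) > ℓ(u)
-- (i.e. u(i) < u(i+1)), and u otherwise.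
demS : (ℕ → ℕ) → ℕ → (ℕ → ℕ)
demS u i = if u i <ᵇ u (suc i) then (λ x → u (s i x)) else u

demWord : (ℕ → ℕ) → List ℕ → (ℕ → ℕ)
demWord u as = foldl demS u as

DemProd : Perm → Perm → Perm → Set
DemProd u v z =
  Σ (List ℕ) λ as →
    (length as ≡ ℓ v) × (∀ x → fun v x ≡ wordFun as x) × (∀ x → demWord (fun u) as x ≡ fun z x)

InA : Perm → Perm → Set
InA y w = DemProd (w ⁻¹) w y × (∀ u → DemProd (u ⁻¹) u y → ℓ w ≤ ℓ u)

-- One covering step of <_𝒜: the one-line representation of v⁻¹ has a
-- consecutive subsequence c a b (positions i, i+1, i+2) with a < b < c,
-- replaced by b c a to give the one-line representation of w⁻¹.
AStep : Perm → Perm → Set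
AStep v w = Σ ℕ λ i → Σ ℕ λ a → Σ ℕ λ b → Σ ℕ λ c →
  (a < b) × (b < c) ×
  (inv v i ≡ c) × (inv v (suc i) ≡ a) × (inv v (suc (suc i)) ≡ b) ×
  (inv w i ≡ b) × (inv w (suc i) ≡ c) × (inv w (suc (suc i)) ≡ a) ×
  (∀ j → j ≢ i → j ≢ suc i → j ≢ suc (suc i) → inv w j ≡ inv v j)

_<A_ : Perm → Perm → Set
v <A w = TransClosure AStep v w

code : Perm → ℕ → ℕ
code w i = count (λ j → (i <ᵇ j) Data.Bool.∧ (fun w j <ᵇ fun w i)) (upTo (bound w))

shape : Perm → List ℕ
shape w = reverse (sort (filter (λ n → 0 <? n) (map (code w) (upTo (bound w)))))

-- dominance order on partitions (lists of parts, padded by zeros)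
_⊴_ : List ℕ → List ℕ → Set
λ₁ ⊴ μ = ∀ k → sum (take k λ₁) ≤ sum (take k μ)

_⊲_ : List ℕ → List ℕ → Set
λ₁ ⊲ μ = (λ₁ ⊴ μ) × (λ₁ ≢ μ)

-- One step cab ↦ bca in the one-line form of v⁻¹ moves the values p + 1, p + 2, p of v at
-- positions a < b < c to p + 2, p, p + 1, and the only pairs whose order changes are (a, b),
-- which becomes an inversion, and (b, c), which stops being one.  Hence the code of w
-- is the code of v with one unit moved from entry b to entry a, where c(v)_b ≤ c(v)_a: a unit
-- passes from a part to a part at least as large.  Such a move raises every partial sum
-- λ₁ + ⋯ + λ_k weakly and one of them strictly, as is seen from λ₁ + ⋯ + λ_k = Σ_t min(k, λ′_t)
-- with λ′ the conjugate partition, which the move changes in only two columns.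

module Submission where

open import Algebra.Properties.CommutativeSemigroup as CommSemigroupProps using ()
open import Data.Bool using (Bool; true; false; _∧_)
open import Data.Bool.Properties using (T-≡; T-∧; ∧-zeroʳ)
open import Data.List using (List; []; _∷_; _++_; [_]; map; filter; reverse; take; upTo)
open import Data.List.Properties using (map-∘; map-++; upTo-∷ʳ; unfold-reverse; length-filter; length-upTo)
open import Data.List.Relation.Unary.All as All using (All; []; _∷_)
open import Data.List.Relation.Unary.All.Properties as AllP using ()
open import Data.List.Relation.Unary.AllPairs using (AllPairs; []; _∷_)
open import Data.List.Relation.Unary.AllPairs.Properties as AllPairsP using ()
open import Data.List.Relation.Unary.Linked.Properties using (Linked⇒AllPairs)
open import Data.List.Relation.Binary.Permutation.Propositional using (_↭_; ↭-sym; ↭-trans)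
open import Data.List.Relation.Binary.Permutation.Propositional.Properties using (All-resp-↭; ↭-reverse; map⁺)
open import Data.Nat using (ℕ; zero; suc; _+_; _≤_; _<_; _≥_; _<ᵇ_; _⊓_; _⊔_; _≟_; _<?_; z≤n)
open import Data.Nat.ListAction using (sum)
open import Data.Nat.Tactic.RingSolver using (solve-∀)
open import Data.Nat.ListAction.Properties using (sum-++; sum-↭)
open import Data.Nat.Properties
open import Data.List.Sort.MergeSort ≤-decTotalOrder using (sort)
open import Data.List.Sort.MergeSort.Properties ≤-decTotalOrder using (sort-↭; sort-↗)
open import Data.Product using (_×_; _,_; ∃-syntax)
open import Data.Sum using (_⊎_; inj₁; inj₂)
open import Function using (_∘_; flip)
open import Function.Bundles using (Equivalence)
open import Relation.Binary.Construct.Closure.Transitive as Plus using ()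
open import Relation.Binary.Definitions using (tri<; tri≈; tri>)
open import Relation.Binary.PropositionalEquality
  using (_≡_; _≢_; refl; sym; trans; cong; cong₂; subst; subst₂; ≢-sym; module ≡-Reasoning)
open import Relation.Nullary using (yes; no; contradiction)

open import Defs

open CommSemigroupProps +-commutativeSemigroup using (interchange; xy∙z≈xz∙y)
open ≡-Reasoning

ind : Bool → ℕ
ind true  = 1
ind false = 0

<⇒<ᵇ≡true : ∀ {m n} → m < n → (m <ᵇ n) ≡ true
<⇒<ᵇ≡true m<n = Equivalence.to T-≡ (<⇒<ᵇ m<n)

<ᵇ≡true⇒< : ∀ {m n} → (m <ᵇ n) ≡ true → m < n
<ᵇ≡true⇒< {m} {n} m<ᵇn = <ᵇ⇒< m n (Equivalence.from T-≡ m<ᵇn)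

≥⇒<ᵇ≡false : ∀ {m n} → n ≤ m → (m <ᵇ n) ≡ false
≥⇒<ᵇ≡false {m} {n} n≤m with m <ᵇ n in m<ᵇn
... | false = refl
... | true  = contradiction (<ᵇ≡true⇒< m<ᵇn) (≤⇒≯ n≤m)

ind-mono : ∀ {x y} → (x ≡ true → y ≡ true) → ind x ≤ ind y
ind-mono {false} _   = z≤n
ind-mono {true}  imp rewrite imp refl = ≤-refl

𝟙[_<_] : ℕ → ℕ → ℕ
𝟙[ m < n ] = ind (m <ᵇ n)

𝟙[<]≡1 : ∀ {m n} → m < n → 𝟙[ m < n ] ≡ 1
𝟙[<]≡1 m<n = cong ind (<⇒<ᵇ≡true m<n)

𝟙[<]≡0 : ∀ {m n} → n ≤ m → 𝟙[ m < n ] ≡ 0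
𝟙[<]≡0 n≤m = cong ind (≥⇒<ᵇ≡false n≤m)

𝟙[<]-mono : ∀ {m n m′ n′} → (m < n → m′ < n′) → 𝟙[ m < n ] ≤ 𝟙[ m′ < n′ ]
𝟙[<]-mono m<n⇒m′<n′ = ind-mono (λ m<ᵇn → <⇒<ᵇ≡true (m<n⇒m′<n′ (<ᵇ≡true⇒< m<ᵇn)))

𝟙[<]-suc : ∀ {t z} → t ≢ z → 𝟙[ t < suc z ] ≡ 𝟙[ t < z ]
𝟙[<]-suc {t} {z} t≢z with <-cmp t z
... | tri< t<z _ _ = trans (𝟙[<]≡1 (m<n⇒m<1+n t<z)) (sym (𝟙[<]≡1 t<z))
... | tri≈ _ t≡z _ = contradiction t≡z t≢z
... | tri> _ _ t>z = trans (𝟙[<]≡0 t>z) (sym (𝟙[<]≡0 (<⇒≤ t>z)))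

+𝟙-cancel-≤ : ∀ {m n a b c d} → m + 𝟙[ a < b ] ≡ n + 𝟙[ c < d ] → (a < b → c < d) → n ≤ m
+𝟙-cancel-≤ {m} {n} {a} {b} {c} {d} eq a<b⇒c<d with a <? b
... | yes a<b = ≤-reflexive (+-cancelʳ-≡ 1 n m (begin
  n + 1             ≡⟨ cong (n +_) (𝟙[<]≡1 (a<b⇒c<d a<b)) ⟨
  n + 𝟙[ c < d ]    ≡⟨ eq ⟨
  m + 𝟙[ a < b ]    ≡⟨ cong (m +_) (𝟙[<]≡1 a<b) ⟩
  m + 1             ∎))
... | no  a≮b = ≤-trans (m≤m+n n _) (≤-reflexive (begin
  n + 𝟙[ c < d ]    ≡⟨ eq ⟨
  m + 𝟙[ a < b ]    ≡⟨ cong (m +_) (𝟙[<]≡0 (≮⇒≥ a≮b)) ⟩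
  m + 0             ≡⟨ +-identityʳ m ⟩
  m                 ∎))

⊓-sucʳ : ∀ k n → k ⊓ suc n ≡ k ⊓ n + 𝟙[ n < k ]
⊓-sucʳ zero    n       = refl
⊓-sucʳ (suc k) zero    = cong suc (⊓-zeroʳ k)
⊓-sucʳ (suc k) (suc n) = cong suc (⊓-sucʳ k n)

∑< : ℕ → (ℕ → ℕ) → ℕ
∑< zero    f = 0
∑< (suc n) f = ∑< n f + f n

syntax ∑< n (λ i → e) = ∑[ i < n ] e

∑<-0 : ∀ n → ∑[ i < n ] 0 ≡ 0
∑<-0 zero    = refl
∑<-0 (suc n) = trans (+-identityʳ _) (∑<-0 n)

∑<-cong : ∀ n {f g} → (∀ i → i < n → f i ≡ g i) → ∑< n f ≡ ∑< n g
∑<-cong zero    f≡g = refl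
∑<-cong (suc n) f≡g = cong₂ _+_ (∑<-cong n (λ i i<n → f≡g i (m<n⇒m<1+n i<n))) (f≡g n (n<1+n n))

∑<-+ : ∀ n f g → ∑[ i < n ] (f i + g i) ≡ ∑< n f + ∑< n g
∑<-+ zero    f g = refl
∑<-+ (suc n) f g = trans (cong (_+ (f n + g n)) (∑<-+ n f g)) (interchange (∑< n f) (∑< n g) (f n) (g n))

∑<-mono : ∀ n {f g} → (∀ i → i < n → f i ≤ g i) → ∑< n f ≤ ∑< n g
∑<-mono zero    f≤g = z≤n
∑<-mono (suc n) f≤g = +-mono-≤ (∑<-mono n (λ i i<n → f≤g i (m<n⇒m<1+n i<n))) (f≤g n (n<1+n n))

∑<-mono-< : ∀ n {f g a} → (∀ i → i < n → f i ≤ g i) → a < n → f a < g a → ∑< n f < ∑< n g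
∑<-mono-< (suc n) {a = a} f≤g a<1+n fa<ga with a ≟ n
... | yes refl = +-mono-≤-< (∑<-mono n (λ i i<n → f≤g i (m<n⇒m<1+n i<n))) fa<ga
... | no  a≢n  = +-mono-<-≤ (∑<-mono-< n (λ i i<n → f≤g i (m<n⇒m<1+n i<n)) (≤∧≢⇒< (≤-pred a<1+n) a≢n) fa<ga)
                            (f≤g n (n<1+n n))

∑<-extend : ∀ {f} b B → b ≤ B → (∀ i → b ≤ i → f i ≡ 0) → ∑< B f ≡ ∑< b f
∑<-extend b zero    z≤n      f≡0 = refl
∑<-extend b (suc B) b≤1+B   f≡0 with m≤n⇒m<n∨m≡n b≤1+B
... | inj₂ refl = refl
... | inj₁ b<1+B = trans (cong₂ _+_ (∑<-extend b B (≤-pred b<1+B) f≡0) (f≡0 B (≤-pred b<1+B))) (+-identityʳ _)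

∑<-update : ∀ n {f g a} → a < n → (∀ i → i ≢ a → g i ≡ f i) →
            ∑< n g + f a ≡ ∑< n f + g a
∑<-update (suc n) {f} {g} {a} a<1+n g≡f with n ≟ a
... | yes refl = begin
  ∑< n g + g n + f n  ≡⟨ cong (λ s → s + g n + f n) (∑<-cong n (λ i i<n → g≡f i (<⇒≢ i<n))) ⟩
  ∑< n f + g n + f n  ≡⟨ xy∙z≈xz∙y (∑< n f) (g n) (f n) ⟩
  ∑< n f + f n + g n  ∎
... | no n≢a = begin
  ∑< n g + g n + f a  ≡⟨ xy∙z≈xz∙y (∑< n g) (g n) (f a) ⟩
  ∑< n g + f a + g n  ≡⟨ cong₂ _+_ (∑<-update n (≤∧≢⇒< (≤-pred a<1+n) (≢-sym n≢a)) g≡f) (g≡f n n≢a) ⟩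
  ∑< n f + g a + f n  ≡⟨ xy∙z≈xz∙y (∑< n f) (g a) (f n) ⟩
  ∑< n f + f n + g a  ∎

∑<-update₂ : ∀ n {f g x y} → x < n → y < n → x ≢ y → (∀ i → i ≢ x → i ≢ y → g i ≡ f i) →
             ∑< n g + (f x + f y) ≡ ∑< n f + (g x + g y)
∑<-update₂ n {f} {g} {x} {y} x<n y<n x≢y g≡f = begin
  ∑< n g + (f x + f y)  ≡⟨ sym (+-assoc (∑< n g) (f x) (f y)) ⟩
  ∑< n g + f x + f y    ≡⟨ cong (λ z → ∑< n g + z + f y) (sym (h≡f x x≢y)) ⟩
  ∑< n g + h x + f y    ≡⟨ cong (_+ f y) (∑<-update n x<n g≡h) ⟩
  ∑< n h + g x + f y    ≡⟨ xy∙z≈xz∙y (∑< n h) (g x) (f y) ⟩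
  ∑< n h + f y + g x    ≡⟨ cong (_+ g x) (∑<-update n y<n h≡f) ⟩
  ∑< n f + h y + g x    ≡⟨ cong (λ z → ∑< n f + z + g x) h-at-y ⟩
  ∑< n f + g y + g x    ≡⟨ +-assoc (∑< n f) (g y) (g x) ⟩
  ∑< n f + (g y + g x)  ≡⟨ cong (∑< n f +_) (+-comm (g y) (g x)) ⟩
  ∑< n f + (g x + g y)  ∎
  where
  h : ℕ → ℕ
  h i with i ≟ y
  ... | yes _ = g i
  ... | no  _ = f i

  h≡f : ∀ i → i ≢ y → h i ≡ f i
  h≡f i i≢y with i ≟ y
  ... | yes i≡y = contradiction i≡y i≢y
  ... | no  _   = refl

  g≡h : ∀ i → i ≢ x → g i ≡ h i
  g≡h i i≢x with i ≟ y
  ... | yes _   = refl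
  ... | no  i≢y = g≡f i i≢x i≢y

  h-at-y : h y ≡ g y
  h-at-y with y ≟ y
  ... | yes _   = refl
  ... | no  y≢y = contradiction refl y≢y

sum-map-upTo : ∀ f n → sum (map f (upTo n)) ≡ ∑< n f
sum-map-upTo f zero    = refl
sum-map-upTo f (suc n) = begin
  sum (map f (upTo (suc n)))        ≡⟨ cong (sum ∘ map f) (sym (upTo-∷ʳ n)) ⟩
  sum (map f (upTo n ++ [ n ]))     ≡⟨ cong sum (map-++ f (upTo n) [ n ]) ⟩
  sum (map f (upTo n) ++ [ f n ])   ≡⟨ sum-++ (map f (upTo n)) [ f n ] ⟩
  sum (map f (upTo n)) + (f n + 0)  ≡⟨ cong₂ _+_ (sum-map-upTo f n) (+-identityʳ (f n)) ⟩
  ∑< n f + f n                      ∎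

∑<-below : ∀ x M → ∑[ t < M ] 𝟙[ t < x ] ≡ x ⊓ M
∑<-below x zero    = sym (⊓-zeroʳ x)
∑<-below x (suc M) = trans (cong (_+ 𝟙[ M < x ]) (∑<-below x M)) (sym (⊓-sucʳ x M))

countAbove : ℕ → List ℕ → ℕ
countAbove t xs = sum (map (λ x → 𝟙[ t < x ]) xs)

countAbove-≤ : ∀ {t xs} → All (_≤ t) xs → countAbove t xs ≡ 0
countAbove-≤ []           = refl
countAbove-≤ (x≤t ∷ xs≤t) = cong₂ _+_ (𝟙[<]≡0 x≤t) (countAbove-≤ xs≤t)

countAbove-↭ : ∀ t {xs ys} → xs ↭ ys → countAbove t xs ≡ countAbove t ys
countAbove-↭ t xs↭ys = sum-↭ (map⁺ (λ x → 𝟙[ t < x ]) xs↭ys)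

countAbove-positives : ∀ t xs → countAbove t (filter (0 <?_) xs) ≡ countAbove t xs
countAbove-positives t []          = refl
countAbove-positives t (zero ∷ xs)  = countAbove-positives t xs
countAbove-positives t (suc x ∷ xs) = cong (𝟙[ t < suc x ] +_) (countAbove-positives t xs)

Descending : List ℕ → Set
Descending = AllPairs _≥_

AllPairs-reverse : ∀ {A : Set} {R : A → A → Set} {xs} → AllPairs R xs → AllPairs (flip R) (reverse xs)
AllPairs-reverse                []             = []
AllPairs-reverse {xs = x ∷ xs} (x~xs ∷ xs~xs) rewrite unfold-reverse x xs =
  AllPairsP.++⁺ (AllPairs-reverse xs~xs) ([] ∷ []) (All.map (_∷ []) (All-resp-↭ (↭-sym (↭-reverse xs)) x~xs))

sum-take-descending : ∀ k {M} xs → Descending xs → All (_≤ M) xs →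
                      sum (take k xs) ≡ ∑[ t < M ] (k ⊓ countAbove t xs)
sum-take-descending zero    {M} xs       _ _ = sym (∑<-0 M)
sum-take-descending (suc k) {M} []       _ _ = sym (∑<-0 M)
sum-take-descending (suc k) {M} (x ∷ xs) (x≥xs ∷ xs↓) (x≤M ∷ xs≤M) = begin
  x + sum (take k xs)                                       ≡⟨ cong₂ _+_ (trans (∑<-below x M) (m≤n⇒m⊓n≡m x≤M))
                                                                          (sym (sum-take-descending k xs xs↓ xs≤M)) ⟨
  ∑[ t < M ] 𝟙[ t < x ] + ∑[ t < M ] (k ⊓ countAbove t xs)  ≡⟨ ∑<-+ M _ _ ⟨
  ∑[ t < M ] (𝟙[ t < x ] + k ⊓ countAbove t xs)             ≡⟨ ∑<-cong M (λ t _ → largest-first t) ⟨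
  ∑[ t < M ] (suc k ⊓ countAbove t (x ∷ xs))                ∎
  where
  largest-first : ∀ t → suc k ⊓ (𝟙[ t < x ] + countAbove t xs) ≡ 𝟙[ t < x ] + k ⊓ countAbove t xs
  largest-first t with t <? x
  ... | yes t<x rewrite 𝟙[<]≡1 t<x = refl
  ... | no  t≮x rewrite 𝟙[<]≡0 (≮⇒≥ t≮x) | countAbove-≤ (All.map (λ y≤x → ≤-trans y≤x (≮⇒≥ t≮x)) x≥xs) =
    sym (⊓-zeroʳ k)

partitionOf : List ℕ → List ℕ
partitionOf xs = reverse (sort (filter (0 <?_) xs))

sum-take-partitionOf : ∀ k {M} xs → All (_≤ M) xs →
                       sum (take k (partitionOf xs)) ≡ ∑[ t < M ] (k ⊓ countAbove t xs)
sum-take-partitionOf k {M} xs xs≤M = begin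
  sum (take k (partitionOf xs))                     ≡⟨ sum-take-descending k (partitionOf xs) descending
                                                         (All-resp-↭ (↭-sym π) (AllP.filter⁺ (0 <?_) xs≤M)) ⟩
  ∑[ t < M ] (k ⊓ countAbove t (partitionOf xs))    ≡⟨ ∑<-cong M (λ t _ → cong (k ⊓_)
                                                         (trans (countAbove-↭ t π) (countAbove-positives t xs))) ⟩
  ∑[ t < M ] (k ⊓ countAbove t xs)                  ∎
  where
  π : partitionOf xs ↭ filter (0 <?_) xs
  π = ↭-trans (↭-reverse _) (sort-↭ _)

  descending : Descending (partitionOf xs)
  descending = AllPairs-reverse (Linked⇒AllPairs ≤-trans (sort-↗ (filter (0 <?_) xs)))

conjugate : (ℕ → ℕ) → ℕ → ℕ → ℕ
conjugate f B t = ∑[ i < B ] 𝟙[ t < f i ]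

countAbove-upTo : ∀ t f n → countAbove t (map f (upTo n)) ≡ conjugate f n t
countAbove-upTo t f n = trans (cong sum (sym (map-∘ (upTo n)))) (sum-map-upTo (λ i → 𝟙[ t < f i ]) n)

-- When f is bounded by B, the sum of the k largest of f 0, …, f (B − 1) (see sum-take-descending).
sumLargest : (ℕ → ℕ) → ℕ → ℕ → ℕ
sumLargest f B k = ∑[ t < B ] (k ⊓ conjugate f B t)

module BoxMove {n n′ : ℕ → ℕ} {M X Y : ℕ} (X<M : X < M) (Y<M : Y < M) (X≢Y : X ≢ Y)
  (dropX : n X ≡ suc (n′ X)) (raiseY : n′ Y ≡ suc (n Y))
  (others : ∀ t → t ≢ X → t ≢ Y → n′ t ≡ n t) where

  ∑⊓-shift : ∀ k → ∑[ t < M ] (k ⊓ n′ t) + 𝟙[ n′ X < k ] ≡ ∑[ t < M ] (k ⊓ n t) + 𝟙[ n Y < k ]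
  ∑⊓-shift k = +-cancelʳ-≡ (k ⊓ n′ X + k ⊓ n Y) _ _ (begin
    ∑n′ + 𝟙[ n′ X < k ] + (k ⊓ n′ X + k ⊓ n Y)
      ≡⟨ regroup ∑n′ 𝟙[ n′ X < k ] (k ⊓ n′ X) (k ⊓ n Y) ⟩
    ∑n′ + (k ⊓ n′ X + 𝟙[ n′ X < k ] + k ⊓ n Y)
      ≡⟨ cong (λ z → ∑n′ + (z + k ⊓ n Y)) (⊓-sucʳ k (n′ X)) ⟨
    ∑n′ + (k ⊓ suc (n′ X) + k ⊓ n Y)
      ≡⟨ cong (λ z → ∑n′ + (k ⊓ z + k ⊓ n Y)) dropX ⟨
    ∑n′ + (k ⊓ n X + k ⊓ n Y)
      ≡⟨ ∑<-update₂ M X<M Y<M X≢Y (λ t t≢X t≢Y → cong (k ⊓_) (others t t≢X t≢Y)) ⟩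
    ∑n + (k ⊓ n′ X + k ⊓ n′ Y)
      ≡⟨ cong (λ z → ∑n + (k ⊓ n′ X + k ⊓ z)) raiseY ⟩
    ∑n + (k ⊓ n′ X + k ⊓ suc (n Y))
      ≡⟨ cong (λ z → ∑n + (k ⊓ n′ X + z)) (⊓-sucʳ k (n Y)) ⟩
    ∑n + (k ⊓ n′ X + (k ⊓ n Y + 𝟙[ n Y < k ]))
      ≡⟨ regroup′ ∑n (k ⊓ n′ X) (k ⊓ n Y) 𝟙[ n Y < k ] ⟩
    ∑n + 𝟙[ n Y < k ] + (k ⊓ n′ X + k ⊓ n Y)
      ∎)
    where
    ∑n ∑n′ : ℕ
    ∑n  = ∑[ t < M ] (k ⊓ n t)
    ∑n′ = ∑[ t < M ] (k ⊓ n′ t)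
    regroup : ∀ a e b c → a + e + (b + c) ≡ a + (b + e + c)
    regroup = solve-∀
    regroup′ : ∀ a b c e → a + (b + (c + e)) ≡ a + e + (b + c)
    regroup′ = solve-∀

  module _ (nY<n′X : n Y < n′ X) where

    ∑⊓-mono : ∀ k → ∑[ t < M ] (k ⊓ n t) ≤ ∑[ t < M ] (k ⊓ n′ t)
    ∑⊓-mono k = +𝟙-cancel-≤ {b = k} {d = k} (∑⊓-shift k) (<-trans nY<n′X)

    ∑⊓-mono-< : ∑[ t < M ] (suc (n Y) ⊓ n t) < ∑[ t < M ] (suc (n Y) ⊓ n′ t)
    ∑⊓-mono-< = ≤-reflexive (begin
      suc (∑[ t < M ] (k ⊓ n t))             ≡⟨ +-comm 1 _ ⟩
      ∑[ t < M ] (k ⊓ n t) + 1               ≡⟨ cong (∑[ t < M ] (k ⊓ n t) +_) (𝟙[<]≡1 (n<1+n (n Y))) ⟨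
      ∑[ t < M ] (k ⊓ n t) + 𝟙[ n Y < k ]    ≡⟨ ∑⊓-shift k ⟨
      ∑[ t < M ] (k ⊓ n′ t) + 𝟙[ n′ X < k ]  ≡⟨ cong (∑[ t < M ] (k ⊓ n′ t) +_) (𝟙[<]≡0 nY<n′X) ⟩
      ∑[ t < M ] (k ⊓ n′ t) + 0              ≡⟨ +-identityʳ _ ⟩
      ∑[ t < M ] (k ⊓ n′ t)                  ∎)
      where k = suc (n Y)

record UnitTransfer (f g : ℕ → ℕ) (B : ℕ) : Set where
  field
    {receiver donor} : ℕ
    receiver<B : receiver < B
    donor<B    : donor < B
    gain       : g receiver ≡ suc (f receiver)
    loss       : f donor ≡ suc (g donor)
    others     : ∀ i → i ≢ receiver → i ≢ donor → g i ≡ f i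
    donor≤receiver : f donor ≤ f receiver

module ConjugateOfTransfer {f g B} (T : UnitTransfer f g B) where
  open UnitTransfer T

  X Y : ℕ
  X = g donor
  Y = f receiver

  X<Y : X < Y
  X<Y = subst (_≤ Y) loss donor≤receiver

  receiver≢donor : receiver ≢ donor
  receiver≢donor refl = <⇒≢ (m<n⇒m<1+n (n<1+n _)) (trans gain (cong suc loss))

  cf cg : ℕ → ℕ
  cf = conjugate f B
  cg = conjugate g B

  shift : ∀ t → cg t + (𝟙[ t < Y ] + 𝟙[ t < suc X ]) ≡ cf t + (𝟙[ t < suc Y ] + 𝟙[ t < X ])
  shift t = begin
    cg t + (𝟙[ t < Y ] + 𝟙[ t < suc X ])           ≡⟨ cong (λ z → cg t + (𝟙[ t < Y ] + 𝟙[ t < z ])) loss ⟨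
    cg t + (𝟙[ t < f receiver ] + 𝟙[ t < f donor ]) ≡⟨ ∑<-update₂ B receiver<B donor<B receiver≢donor
                                                        (λ i i≢r i≢d → cong (λ z → 𝟙[ t < z ]) (others i i≢r i≢d)) ⟩
    cf t + (𝟙[ t < g receiver ] + 𝟙[ t < g donor ]) ≡⟨ cong (λ z → cf t + (𝟙[ t < z ] + 𝟙[ t < X ])) gain ⟩
    cf t + (𝟙[ t < suc Y ] + 𝟙[ t < X ])           ∎

  conjugate-drop : cf X ≡ suc (cg X)
  conjugate-drop = +-cancelʳ-≡ 1 _ _ (begin
    cf X + 1                                ≡⟨ cong (cf X +_) (cong₂ _+_ (𝟙[<]≡1 (m<n⇒m<1+n X<Y)) (𝟙[<]≡0 (≤-refl {X}))) ⟨
    cf X + (𝟙[ X < suc Y ] + 𝟙[ X < X ])    ≡⟨ shift X ⟨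
    cg X + (𝟙[ X < Y ] + 𝟙[ X < suc X ])    ≡⟨ cong (cg X +_) (cong₂ _+_ (𝟙[<]≡1 X<Y) (𝟙[<]≡1 (n<1+n X))) ⟩
    cg X + 2                                ≡⟨ +-suc (cg X) 1 ⟩
    suc (cg X) + 1                          ∎)

  conjugate-raise : cg Y ≡ suc (cf Y)
  conjugate-raise = begin
    cg Y                                    ≡⟨ +-identityʳ _ ⟨
    cg Y + 0                                ≡⟨ cong (cg Y +_) (cong₂ _+_ (𝟙[<]≡0 (≤-refl {Y})) (𝟙[<]≡0 X<Y)) ⟨
    cg Y + (𝟙[ Y < Y ] + 𝟙[ Y < suc X ])    ≡⟨ shift Y ⟩
    cf Y + (𝟙[ Y < suc Y ] + 𝟙[ Y < X ])    ≡⟨ cong (cf Y +_) (cong₂ _+_ (𝟙[<]≡1 (n<1+n Y)) (𝟙[<]≡0 (<⇒≤ X<Y))) ⟩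
    cf Y + 1                                ≡⟨ +-comm _ 1 ⟩
    suc (cf Y)                              ∎

  conjugate-others : ∀ t → t ≢ X → t ≢ Y → cg t ≡ cf t
  conjugate-others t t≢X t≢Y = +-cancelʳ-≡ (𝟙[ t < Y ] + 𝟙[ t < X ]) _ _ (begin
    cg t + (𝟙[ t < Y ] + 𝟙[ t < X ])        ≡⟨ cong (λ z → cg t + (𝟙[ t < Y ] + z)) (𝟙[<]-suc t≢X) ⟨
    cg t + (𝟙[ t < Y ] + 𝟙[ t < suc X ])    ≡⟨ shift t ⟩
    cf t + (𝟙[ t < suc Y ] + 𝟙[ t < X ])    ≡⟨ cong (λ z → cf t + (z + 𝟙[ t < X ])) (𝟙[<]-suc t≢Y) ⟩
    cf t + (𝟙[ t < Y ] + 𝟙[ t < X ])        ∎)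

  conjugate-Y<conjugate-X : cf Y < cg X
  conjugate-Y<conjugate-X = ∑<-mono-< B (λ i _ → 𝟙[<]-mono (above-Y⇒above-X i)) receiver<B
    (subst₂ _<_ (sym (𝟙[<]≡0 (≤-refl {Y}))) (sym (𝟙[<]≡1 X<g-receiver)) ≤-refl)
    where
    X<g-receiver : X < g receiver
    X<g-receiver = subst (X <_) (sym gain) (m<n⇒m<1+n X<Y)

    above-Y⇒above-X : ∀ i → Y < f i → X < g i
    above-Y⇒above-X i Y<fi with i ≟ receiver | i ≟ donor
    ... | yes refl | _        = contradiction Y<fi (<-irrefl refl)
    ... | no _     | yes refl = contradiction Y<fi (≤⇒≯ (subst (_≤ Y) (sym loss) X<Y))
    ... | no i≢r   | no i≢d   = subst (X <_) (sym (others i i≢r i≢d)) (<-trans X<Y Y<fi)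

sumLargest-transfer : ∀ {f g B} → UnitTransfer f g B → (∀ i → g i ≤ B) →
  (∀ k → sumLargest f B k ≤ sumLargest g B k) × ∃[ k ] sumLargest f B k < sumLargest g B k
sumLargest-transfer {f} {g} {B} T g≤B =
  moved.∑⊓-mono conjugate-Y<conjugate-X , _ , moved.∑⊓-mono-< conjugate-Y<conjugate-X
  where
  open UnitTransfer T
  open ConjugateOfTransfer T

  Y<B : Y < B
  Y<B = <-≤-trans (subst (Y <_) (sym gain) (n<1+n Y)) (g≤B receiver)

  module moved = BoxMove (<-trans X<Y Y<B) Y<B (<⇒≢ X<Y) conjugate-drop conjugate-raise conjugate-others

inv≡⇒fun≡ : ∀ u {r s} → inv u r ≡ s → fun u s ≡ r
inv≡⇒fun≡ u {r} u⁻¹r≡s = subst (λ z → fun u z ≡ r) u⁻¹r≡s (invʳ u r)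

fun≡⇒inv≡ : ∀ u {r s} → fun u s ≡ r → inv u r ≡ s
fun≡⇒inv≡ u {s = s} us≡r = trans (cong (inv u) (sym us≡r)) (invˡ u s)

fun-<-bound : ∀ u {x} → x < bound u → fun u x < bound u
fun-<-bound u {x} x<b with fun u x <? bound u
... | yes ux<b = ux<b
... | no  ux≮b = contradiction (subst (bound u ≤_) ux≡x (≮⇒≥ ux≮b)) (<⇒≱ x<b)
  where
  ux≡x : fun u x ≡ x
  ux≡x = trans (sym (fun≡⇒inv≡ u (fix u (fun u x) (≮⇒≥ ux≮b)))) (invˡ u x)

bound≤fun⇒bound≤ : ∀ u {x} → bound u ≤ fun u x → bound u ≤ x
bound≤fun⇒bound≤ u b≤ux = ≮⇒≥ (λ x<b → <⇒≱ (fun-<-bound u x<b) b≤ux)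

isInversion : Perm → ℕ → ℕ → Bool
isInversion u i j = (i <ᵇ j) ∧ (fun u j <ᵇ fun u i)

isInversion⇒< : ∀ u {i j} → isInversion u i j ≡ true → i < j × fun u j < fun u i
isInversion⇒< u {i} {j} inv≡true with Equivalence.to T-∧ (Equivalence.from T-≡ inv≡true)
... | i<ᵇj , uj<ᵇui = <ᵇ⇒< i j i<ᵇj , <ᵇ⇒< (fun u j) (fun u i) uj<ᵇui

<⇒isInversion : ∀ u {i j} → i < j → fun u j < fun u i → isInversion u i j ≡ true
<⇒isInversion u i<j uj<ui rewrite <⇒<ᵇ≡true i<j | <⇒<ᵇ≡true uj<ui = refl

count≡sum-map : ∀ p xs → count p xs ≡ sum (map (ind ∘ p) xs)
count≡sum-map p []       = refl
count≡sum-map p (x ∷ xs) with p x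
... | true  = cong suc (count≡sum-map p xs)
... | false = count≡sum-map p xs

code≡∑< : ∀ u {B} i → bound u ≤ B → code u i ≡ ∑[ j < B ] ind (isInversion u i j)
code≡∑< u {B} i b≤B = begin
  code u i                                       ≡⟨ count≡sum-map (isInversion u i) (upTo (bound u)) ⟩
  sum (map (ind ∘ isInversion u i) (upTo (bound u))) ≡⟨ sum-map-upTo (ind ∘ isInversion u i) (bound u) ⟩
  ∑[ j < bound u ] ind (isInversion u i j)       ≡⟨ sym (∑<-extend (bound u) B b≤B no-inversion-beyond) ⟩
  ∑[ j < B ] ind (isInversion u i j)             ∎
  where
  no-inversion-beyond : ∀ j → bound u ≤ j → ind (isInversion u i j) ≡ 0
  no-inversion-beyond j b≤j with i <? bound u | i <? j
  ... | yes i<b | _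
    rewrite fix u j b≤j | ≥⇒<ᵇ≡false (≤-trans (<⇒≤ (fun-<-bound u i<b)) b≤j) | ∧-zeroʳ (i <ᵇ j) = refl
  ... | no  i≮b | yes i<j
    rewrite fix u j b≤j | fix u i (≮⇒≥ i≮b) | ≥⇒<ᵇ≡false (<⇒≤ i<j) | ∧-zeroʳ (i <ᵇ j) = refl
  ... | no  _   | no  i≮j rewrite ≥⇒<ᵇ≡false (≮⇒≥ i≮j) = refl

code-beyond-bound : ∀ u {i} → bound u ≤ i → code u i ≡ 0
code-beyond-bound u {i} b≤i = begin
  code u i                                 ≡⟨ code≡∑< u i ≤-refl ⟩
  ∑[ j < bound u ] ind (isInversion u i j) ≡⟨ ∑<-cong (bound u) (λ j j<b → cong ind (no-inversion-below j j<b)) ⟩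
  ∑[ j < bound u ] 0                       ≡⟨ ∑<-0 (bound u) ⟩
  0                                        ∎
  where
  no-inversion-below : ∀ j → j < bound u → isInversion u i j ≡ false
  no-inversion-below j j<b rewrite ≥⇒<ᵇ≡false (≤-trans (<⇒≤ j<b) b≤i) = refl

code-≤-bound : ∀ u i → code u i ≤ bound u
code-≤-bound u i = ≤-trans (length-filter _ (upTo (bound u))) (≤-reflexive (length-upTo (bound u)))

sum-take-shape : ∀ u {B} → bound u ≤ B → ∀ k → sum (take k (shape u)) ≡ sumLargest (code u) B k
sum-take-shape u {B} b≤B k = begin
  sum (take k (partitionOf codes))     ≡⟨ sum-take-partitionOf k codes codes≤B ⟩
  ∑[ t < B ] (k ⊓ countAbove t codes)  ≡⟨ ∑<-cong B (λ t _ → cong (k ⊓_) (countAbove-codes t)) ⟩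
  sumLargest (code u) B k              ∎
  where
  codes : List ℕ
  codes = map (code u) (upTo (bound u))

  codes≤B : All (_≤ B) codes
  codes≤B = AllP.map⁺ (All.universal (λ i → ≤-trans (code-≤-bound u i) b≤B) _)

  countAbove-codes : ∀ t → countAbove t codes ≡ conjugate (code u) B t
  countAbove-codes t = begin
    countAbove t codes             ≡⟨ countAbove-upTo t (code u) (bound u) ⟩
    conjugate (code u) (bound u) t ≡⟨ ∑<-extend (bound u) B b≤B (λ i b≤i → cong (λ x → 𝟙[ t < x ]) (code-beyond-bound u b≤i)) ⟨
    conjugate (code u) B t         ∎

code-cong : ∀ u u′ {B} x → bound u ≤ B → bound u′ ≤ B →
            (∀ j → isInversion u′ x j ≡ isInversion u x j) → code u′ x ≡ code u x
code-cong u u′ {B} x b≤B b′≤B same = begin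
  code u′ x                            ≡⟨ code≡∑< u′ x b′≤B ⟩
  ∑[ j < B ] ind (isInversion u′ x j)  ≡⟨ ∑<-cong B (λ j _ → cong ind (same j)) ⟩
  ∑[ j < B ] ind (isInversion u x j)   ≡⟨ sym (code≡∑< u x b≤B) ⟩
  code u x                             ∎

code-add-inversion : ∀ u u′ {B} x y → bound u ≤ B → bound u′ ≤ B → y < B →
                     (∀ j → j ≢ y → isInversion u′ x j ≡ isInversion u x j) →
                     isInversion u′ x y ≡ true → isInversion u x y ≡ false → code u′ x ≡ suc (code u x)
code-add-inversion u u′ {B} x y b≤B b′≤B y<B same new old = begin
  code u′ x                    ≡⟨ code≡∑< u′ x b′≤B ⟩
  S′                           ≡⟨ +-identityʳ S′ ⟨
  S′ + 0                       ≡⟨ cong (λ z → S′ + ind z) old ⟨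
  S′ + ind (isInversion u x y)  ≡⟨ ∑<-update B y<B (λ j j≢y → cong ind (same j j≢y)) ⟩
  S + ind (isInversion u′ x y)  ≡⟨ cong (λ z → S + ind z) new ⟩
  S + 1                        ≡⟨ +-comm S 1 ⟩
  suc S                        ≡⟨ cong suc (code≡∑< u x b≤B) ⟨
  suc (code u x)               ∎
  where
  S S′ : ℕ
  S  = ∑[ j < B ] ind (isInversion u x j)
  S′ = ∑[ j < B ] ind (isInversion u′ x j)

code-mono : ∀ u x y → (∀ j → isInversion u x j ≡ true → isInversion u y j ≡ true) → code u x ≤ code u y
code-mono u x y inv⇒inv = subst₂ _≤_ (sym (code≡∑< u x ≤-refl)) (sym (code≡∑< u y ≤-refl))
                            (∑<-mono (bound u) (λ j _ → ind-mono (inv⇒inv j)))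

data Window (p : ℕ) : ℕ → Set where
  p+0 : Window p p
  p+1 : Window p (suc p)
  p+2 : Window p (suc (suc p))

window-≥ : ∀ {p r} → Window p r → p ≤ r
window-≥ {p} p+0 = ≤-refl
window-≥ {p} p+1 = n≤1+n p
window-≥ {p} p+2 = m≤n⇒m≤1+n (n≤1+n p)

window-≤ : ∀ {p r} → Window p r → r ≤ suc (suc p)
window-≤ {p} p+0 = m≤n⇒m≤1+n (n≤1+n p)
window-≤ {p} p+1 = n≤1+n (suc p)
window-≤ {p} p+2 = ≤-refl

Far : ℕ → ℕ → Set
Far p q = q < p ⊎ suc (suc p) < q

far : ∀ {p q} → q ≢ p → q ≢ suc p → q ≢ suc (suc p) → Far p q
far {p} {q} q≢p q≢1+p q≢2+p with <-cmp q p
... | tri< q<p _ _ = inj₁ q<p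
... | tri≈ _ q≡p _ = contradiction q≡p q≢p
... | tri> _ _ p<q = inj₂ (≤∧≢⇒< (≤∧≢⇒< p<q (≢-sym q≢1+p)) (≢-sym q≢2+p))

far-<ᵇ-window : ∀ {p q r r′} → Far p q → Window p r → Window p r′ → (q <ᵇ r) ≡ (q <ᵇ r′)
far-<ᵇ-window (inj₁ q<p)   W W′ = trans (<⇒<ᵇ≡true (<-≤-trans q<p (window-≥ W)))
                                         (sym (<⇒<ᵇ≡true (<-≤-trans q<p (window-≥ W′))))
far-<ᵇ-window (inj₂ p+2<q) W W′ = trans (≥⇒<ᵇ≡false (≤-trans (window-≤ W) (<⇒≤ p+2<q)))
                                         (sym (≥⇒<ᵇ≡false (≤-trans (window-≤ W′) (<⇒≤ p+2<q))))

window-<ᵇ-far : ∀ {p q r r′} → Far p q → Window p r → Window p r′ → (r <ᵇ q) ≡ (r′ <ᵇ q)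
window-<ᵇ-far (inj₁ q<p)   W W′ = trans (≥⇒<ᵇ≡false (<⇒≤ (<-≤-trans q<p (window-≥ W))))
                                         (sym (≥⇒<ᵇ≡false (<⇒≤ (<-≤-trans q<p (window-≥ W′)))))
window-<ᵇ-far (inj₂ p+2<q) W W′ = trans (<⇒<ᵇ≡true (≤-<-trans (window-≤ W) p+2<q))
                                         (sym (<⇒<ᵇ≡true (≤-<-trans (window-≤ W′) p+2<q)))

module CodesUnderStep {v w : Perm} {p a b c : ℕ} (a<b : a < b) (b<c : b < c)
  (v⁻¹p≡c : inv v p ≡ c) (v⁻¹p+1≡a : inv v (suc p) ≡ a) (v⁻¹p+2≡b : inv v (suc (suc p)) ≡ b)
  (w⁻¹p≡b : inv w p ≡ b) (w⁻¹p+1≡c : inv w (suc p) ≡ c) (w⁻¹p+2≡a : inv w (suc (suc p)) ≡ a)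
  (w⁻¹≡v⁻¹ : ∀ j → j ≢ p → j ≢ suc p → j ≢ suc (suc p) → inv w j ≡ inv v j) where

  a<c : a < c
  a<c = <-trans a<b b<c

  vc : fun v c ≡ p
  vc = inv≡⇒fun≡ v v⁻¹p≡c
  va : fun v a ≡ suc p
  va = inv≡⇒fun≡ v v⁻¹p+1≡a
  vb : fun v b ≡ suc (suc p)
  vb = inv≡⇒fun≡ v v⁻¹p+2≡b
  wb : fun w b ≡ p
  wb = inv≡⇒fun≡ w w⁻¹p≡b
  wc : fun w c ≡ suc p
  wc = inv≡⇒fun≡ w w⁻¹p+1≡c
  wa : fun w a ≡ suc (suc p)
  wa = inv≡⇒fun≡ w w⁻¹p+2≡a

  module Outside {j} (j≢a : j ≢ a) (j≢b : j ≢ b) (j≢c : j ≢ c) where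
    vj≢p : fun v j ≢ p
    vj≢p e = j≢c (trans (sym (fun≡⇒inv≡ v e)) v⁻¹p≡c)
    vj≢p+1 : fun v j ≢ suc p
    vj≢p+1 e = j≢a (trans (sym (fun≡⇒inv≡ v e)) v⁻¹p+1≡a)
    vj≢p+2 : fun v j ≢ suc (suc p)
    vj≢p+2 e = j≢b (trans (sym (fun≡⇒inv≡ v e)) v⁻¹p+2≡b)

    v-far : Far p (fun v j)
    v-far = far vj≢p vj≢p+1 vj≢p+2

    w≡v : fun w j ≡ fun v j
    w≡v = begin
      fun w j                   ≡⟨ cong (fun w) (sym (invˡ v j)) ⟩
      fun w (inv v (fun v j))   ≡⟨ cong (fun w) (sym (w⁻¹≡v⁻¹ (fun v j) vj≢p vj≢p+1 vj≢p+2)) ⟩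
      fun w (inv w (fun v j))   ≡⟨ invʳ w (fun v j) ⟩
      fun v j                   ∎

  <ᵇ-far : ∀ {q} → Far p q → ∀ j → (fun w j <ᵇ q) ≡ (fun v j <ᵇ q)
  <ᵇ-far {q} q-far j with j ≟ a | j ≟ b | j ≟ c
  ... | yes refl | _        | _        rewrite wa | va = window-<ᵇ-far q-far p+2 p+1
  ... | no _     | yes refl | _        rewrite wb | vb = window-<ᵇ-far q-far p+0 p+2
  ... | no _     | no _     | yes refl rewrite wc | vc = window-<ᵇ-far q-far p+1 p+0
  ... | no j≢a   | no j≢b   | no j≢c   = cong (_<ᵇ q) (Outside.w≡v j≢a j≢b j≢c)

  inversion-elsewhere : ∀ x → x ≢ a → x ≢ b → ∀ j → isInversion w x j ≡ isInversion v x j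
  inversion-elsewhere x x≢a x≢b j with x ≟ c
  ... | no x≢c rewrite Outside.w≡v x≢a x≢b x≢c = cong ((x <ᵇ j) ∧_) (<ᵇ-far (Outside.v-far x≢a x≢b x≢c) j)
  ... | yes refl with j ≟ a | j ≟ b | j ≟ x
  ...   | yes refl | _        | _        rewrite ≥⇒<ᵇ≡false (<⇒≤ a<c) = refl
  ...   | no _     | yes refl | _        rewrite ≥⇒<ᵇ≡false (<⇒≤ b<c) = refl
  ...   | no _     | no _     | yes refl rewrite ≥⇒<ᵇ≡false (≤-refl {x}) = refl
  ...   | no j≢a   | no j≢b   | no j≢c   rewrite Outside.w≡v j≢a j≢b j≢c | wc | vc =
    cong ((x <ᵇ j) ∧_) (far-<ᵇ-window (Outside.v-far j≢a j≢b j≢c) p+1 p+0)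

  inversion-at-a : ∀ j → j ≢ b → isInversion w a j ≡ isInversion v a j
  inversion-at-a j j≢b with j ≟ a | j ≟ c
  ... | yes refl | _        rewrite ≥⇒<ᵇ≡false (≤-refl {j}) = refl
  ... | no _     | yes refl rewrite wc | wa | vc | va | <⇒<ᵇ≡true (n<1+n p) = refl
  ... | no j≢a   | no j≢c   rewrite Outside.w≡v j≢a j≢b j≢c | wa | va =
    cong ((a <ᵇ j) ∧_) (far-<ᵇ-window (Outside.v-far j≢a j≢b j≢c) p+2 p+1)

  inversion-at-b : ∀ j → j ≢ c → isInversion v b j ≡ isInversion w b j
  inversion-at-b j j≢c with j ≟ a | j ≟ b
  ... | yes refl | _        rewrite ≥⇒<ᵇ≡false (<⇒≤ a<b) = refl
  ... | no _     | yes refl rewrite ≥⇒<ᵇ≡false (≤-refl {j}) = refl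
  ... | no j≢a   | no j≢b   rewrite Outside.w≡v j≢a j≢b j≢c | wb | vb =
    cong ((b <ᵇ j) ∧_) (far-<ᵇ-window (Outside.v-far j≢a j≢b j≢c) p+2 p+0)

  w-inverts-ab : isInversion w a b ≡ true
  w-inverts-ab = <⇒isInversion w a<b (subst₂ _<_ (sym wb) (sym wa) (m<n⇒m<1+n (n<1+n p)))

  v-keeps-ab : isInversion v a b ≡ false
  v-keeps-ab rewrite vb | va | ≥⇒<ᵇ≡false (n≤1+n (suc p)) = ∧-zeroʳ (a <ᵇ b)

  v-inverts-bc : isInversion v b c ≡ true
  v-inverts-bc = <⇒isInversion v b<c (subst₂ _<_ (sym vc) (sym vb) (m<n⇒m<1+n (n<1+n p)))

  w-keeps-bc : isInversion w b c ≡ false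
  w-keeps-bc rewrite wc | wb | ≥⇒<ᵇ≡false (n≤1+n p) = ∧-zeroʳ (b <ᵇ c)

  inversion-b⇒inversion-a : ∀ j → isInversion v b j ≡ true → isInversion v a j ≡ true
  inversion-b⇒inversion-a j inv-bj with isInversion⇒< v inv-bj | j ≟ c
  ... | b<j , _ | yes refl = <⇒isInversion v (<-trans a<b b<j) (subst₂ _<_ (sym vc) (sym va) (n<1+n p))
  ... | b<j , vj<vb | no j≢c with Outside.v-far (≢-sym (<⇒≢ (<-trans a<b b<j))) (≢-sym (<⇒≢ b<j)) j≢c
  ...   | inj₁ vj<p   = <⇒isInversion v (<-trans a<b b<j) (subst (fun v j <_) (sym va) (m<n⇒m<1+n vj<p))
  ...   | inj₂ p+2<vj = contradiction (subst (fun v j <_) vb vj<vb) (<⇒≯ p+2<vj)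

  B : ℕ
  B = bound v ⊔ bound w

  v≤B : bound v ≤ B
  v≤B = m≤m⊔n (bound v) (bound w)

  w≤B : bound w ≤ B
  w≤B = m≤n⊔m (bound v) (bound w)

  c<B : c < B
  c<B with c <? bound v
  ... | yes c<bv = <-≤-trans c<bv v≤B
  ... | no  c≮bv = contradiction (subst₂ _<_ b≡p+2 c≡p b<c) (≤⇒≯ (window-≤ p+0))
    where
    bv≤c : bound v ≤ c
    bv≤c = ≮⇒≥ c≮bv
    c≡p : c ≡ p
    c≡p = trans (sym (fix v c bv≤c)) vc
    bv≤b : bound v ≤ b
    bv≤b = bound≤fun⇒bound≤ v (≤-trans bv≤c (subst (c ≤_) (sym vb) (≤-trans (≤-reflexive c≡p) (window-≤ p+0))))
    b≡p+2 : b ≡ suc (suc p)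
    b≡p+2 = trans (sym (fix v b bv≤b)) vb

  b<B : b < B
  b<B = <-trans b<c c<B

  unitTransfer : UnitTransfer (code v) (code w) B
  unitTransfer = record
    { receiver<B     = <-trans a<b b<B
    ; donor<B        = b<B
    ; gain           = code-add-inversion v w a b v≤B w≤B b<B inversion-at-a w-inverts-ab v-keeps-ab
    ; loss           = code-add-inversion w v b c w≤B v≤B c<B inversion-at-b v-inverts-bc w-keeps-bc
    ; others         = λ x x≢a x≢b → code-cong v w x v≤B w≤B (inversion-elsewhere x x≢a x≢b)
    ; donor≤receiver = code-mono v b a inversion-b⇒inversion-a
    }

AStep⇒UnitTransfer : ∀ {v w} → AStep v w → UnitTransfer (code v) (code w) (bound v ⊔ bound w)
AStep⇒UnitTransfer {v} {w} (_ , _ , _ , _ , a<b , b<c , v₁ , v₂ , v₃ , w₁ , w₂ , w₃ , elsewhere) =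
  CodesUnderStep.unitTransfer {v} {w} a<b b<c v₁ v₂ v₃ w₁ w₂ w₃ elsewhere

-- Unlike _⊲_, this witnessed form is transitive without antisymmetry of _⊴_.
_⊲′_ : List ℕ → List ℕ → Set
λ₁ ⊲′ μ = λ₁ ⊴ μ × ∃[ k ] sum (take k λ₁) < sum (take k μ)

⊲′-trans : ∀ {λ₁ μ ν} → λ₁ ⊲′ μ → μ ⊲′ ν → λ₁ ⊲′ ν
⊲′-trans (λ⊴μ , k , λ<μ) (μ⊴ν , _) = (λ j → ≤-trans (λ⊴μ j) (μ⊴ν j)) , k , <-≤-trans λ<μ (μ⊴ν k)

⊲′⇒⊲ : ∀ {λ₁ μ} → λ₁ ⊲′ μ → λ₁ ⊲ μ
⊲′⇒⊲ (λ⊴μ , k , λ<μ) = λ⊴μ , λ λ≡μ → <-irrefl (cong (sum ∘ take k) λ≡μ) λ<μ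

⊲′-via-prefix-sums : ∀ {λ₁ μ} {f g : ℕ → ℕ} →
                     (∀ k → sum (take k λ₁) ≡ f k) → (∀ k → sum (take k μ) ≡ g k) →
                     (∀ k → f k ≤ g k) × ∃[ k ] f k < g k → λ₁ ⊲′ μ
⊲′-via-prefix-sums λ≡f μ≡g (f≤g , k , f<g) =
  (λ j → subst₂ _≤_ (sym (λ≡f j)) (sym (μ≡g j)) (f≤g j)) , k , subst₂ _<_ (sym (λ≡f k)) (sym (μ≡g k)) f<g

AStep⇒shape⊲′ : ∀ {v w} → AStep v w → shape v ⊲′ shape w
AStep⇒shape⊲′ {v} {w} step =
  ⊲′-via-prefix-sums (sum-take-shape v v≤B) (sum-take-shape w w≤B)
    (sumLargest-transfer (AStep⇒UnitTransfer {v} {w} step) (λ i → ≤-trans (code-≤-bound w i) w≤B))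
  where
  v≤B : bound v ≤ bound v ⊔ bound w
  v≤B = m≤m⊔n (bound v) (bound w)
  w≤B : bound w ≤ bound v ⊔ bound w
  w≤B = m≤n⊔m (bound v) (bound w)

<A⇒shape⊲′ : ∀ {v w} → v <A w → shape v ⊲′ shape w
<A⇒shape⊲′ {v} {w} Plus.[ step ]                = AStep⇒shape⊲′ {v} {w} step
<A⇒shape⊲′ {v} {w} (Plus._∷_ {y = u} step steps) =
  ⊲′-trans (AStep⇒shape⊲′ {v} {u} step) (<A⇒shape⊲′ {u} {w} steps)

lemma4p40 : (y : Perm) → IsInvolution y → (v w : Perm) →
    InA y v → InA y w → v <A w → shape v ⊲ shape w
lemma4p40 _ _ v w _ _ v<w = ⊲′⇒⊲ (<A⇒shape⊲′ {v} {w} v<w)
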